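{- For each $r \in \mathbb{N}$, $$\lim_{\substack{n\in D_r\\ n\to\infty}} \frac{\mathrm{IR}(X_n)}{\alpha(X_n)} = 1,$$ where $D_r = \{x\in\mathbb{N} : \text{there exists } d\in\{2,3,\dots,r\} \text{ with } d\mid x\}$.
   Context: $X_n$ is the graph on $\{0,\dots,n-1\}$ with $a,b$ adjacent iff $\gcd(a-b,n)=1$. $\alpha(G)$ is the maximum size of an independent set. A set $S$ of vertices is irredundant if every $v\in S$ has a private neighbor, i.e. a vertex in the closed neighborhood of $v$ not in the closed neighborhood of any vertex of $S\setminus\{v\}$; $\mathrm{IR}(G)$ is the maximum size of an irredundant set. $\mathbb{N}=\{1,2,3,\dots\}$. -}

module Defs where

open import Data.Nat using (ℕ; suc; _≤_; _<_; _*_; ∣_-_∣)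
open import Data.Nat.GCD using (gcd)
open import Data.Nat.Divisibility using (_∣_)
open import Data.Fin using (Fin; toℕ)
open import Data.Fin.Subset using (Subset; _∈_; ∣_∣)
open import Data.Product using (Σ; ∃; ∃-syntax; _×_)
open import Data.Sum using (_⊎_)
open import Relation.Nullary using (¬_)
open import Relation.Binary.PropositionalEquality using (_≡_; _≢_)

-- Adjacency in X_n (vertices 0..n-1 as Fin n): distinct a, b with gcd(|a-b|, n) = 1.
Adj : (n : ℕ) → Fin n → Fin n → Set
Adj n a b = (toℕ a ≢ toℕ b) × (gcd ∣ toℕ a - toℕ b ∣ n ≡ 1)

InClosedNbhd : (n : ℕ) → Fin n → Fin n → Set
InClosedNbhd n u v = (u ≡ v) ⊎ Adj n v u

Independent : (n : ℕ) → Subset n → Set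
Independent n S = ∀ a b → a ∈ S → b ∈ S → ¬ Adj n a b

Irredundant : (n : ℕ) → Subset n → Set
Irredundant n S = ∀ v → v ∈ S →
  ∃[ u ] (InClosedNbhd n u v × (∀ w → w ∈ S → w ≢ v → ¬ InClosedNbhd n u w))

IsMaxSize : (n : ℕ) → (Subset n → Set) → ℕ → Set
IsMaxSize n P m = (∃[ S ] (P S × ∣ S ∣ ≡ m)) × (∀ S → P S → ∣ S ∣ ≤ m)

IsAlpha : ℕ → ℕ → Set
IsAlpha n a = IsMaxSize n (Independent n) a

IsIR : ℕ → ℕ → Set
IsIR n i = IsMaxSize n (Irredundant n) i

-- n ∈ D_r  (n ∈ ℕ = {1,2,...})
InD : ℕ → ℕ → Set
InD r n = 1 ≤ n × ∃[ d ] (2 ≤ d × d ≤ r × d ∣ n)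

module Submission where

-- Fix r, k and put K = 2r(k+1).  Always α ≤ IR, since an independent set is irredundant.
-- Conversely, split a maximum irredundant set S into the members with no neighbour in S
-- (an independent set, so at most α of them) and the remaining members v, each of which
-- has a private neighbour u_v ≠ v.  The pairs (v, u_v) form a *cross family* modulo n:
-- v − u_v is coprime to n, while v − u_w and w − u_v are not, for v ≠ w.  Hence
-- IR ≤ α + L with L the size of a cross family modulo n.
--
-- The arithmetic heart is a bound on cross families modulo M, by induction on the prime
-- factorisation of M = q·M′: a family of Boolean tests on residues mod q that separates
-- any two distinct residues splits a cross family modulo M into cross families modulo M′.
-- Using the q point tests for primes q < Q = (2K+1)·2K and the 2K + q/2K + 1 ≤ q/K digit
-- tests in base 2K for larger primes, this gives L·K ≤ M ⊔ K·gcd(M, Q!), hence L·K ≤ n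
-- once n ≥ K·Q!.  Finally, when d ∣ n with 2 ≤ d ≤ r, the residue classes mod d are d
-- independent sets covering the vertices, so n ≤ r·α.  Together 2(k+1)·L ≤ α, so (k+1)·(IR − α) ≤ (k+1)·L < α.

open import Defs
open import Data.Bool using (Bool; true; false)
import Data.Bool as Bool
open import Data.Empty using (⊥-elim)
open import Data.Fin using (Fin; toℕ; fromℕ<) renaming (zero to fzero; suc to fsuc)
open import Data.Fin.Properties using (toℕ-injective; toℕ-fromℕ<; all?)
open import Data.Fin.Subset using (Subset; _∈_; ∣_∣; inside; outside)
open import Data.Fin.Subset.Properties using (_∈?_; drop-there)
open import Data.List using (List; []; _∷_; length; filter; map; upTo; _++_; allFin)
  renaming (tabulate to tabulateᴸ)
open import Data.List.Membership.Propositional using (lose)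
open import Data.List.Membership.Propositional.Properties using (∈-allFin; ∈-upTo⁺)
open import Data.List.Properties
  using (filter-accept; filter-reject; length-map; length-upTo; length-++; length-tabulate)
open import Data.List.Relation.Unary.All as All using (All; []; _∷_)
import Data.List.Relation.Unary.All.Properties as Allₚ
open import Data.List.Relation.Unary.AllPairs as AllPairs using (AllPairs; []; _∷_)
import Data.List.Relation.Unary.AllPairs.Properties as AllPairsₚ
open import Data.List.Relation.Unary.Any as Any using (Any; here; there)
import Data.List.Relation.Unary.Any.Properties as Anyₚ
open import Data.List.Relation.Unary.Unique.Propositional using (Unique)
open import Data.List.Relation.Unary.Unique.Propositional.Properties using (allFin⁺)
open import Data.Nat
  using (ℕ; zero; suc; _+_; _*_; _∸_; _≤_; _<_; z≤n; s≤s; ∣_-_∣; _%_; _/_; _⊔_; _!; _≟_; _<?_;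
         NonZero; >-nonZero; >-nonZero⁻¹; ≢-nonZero; ≢-nonZero⁻¹)
open import Data.Nat.Properties
open import Algebra.Properties.CommutativeSemigroup *-commutativeSemigroup using (x∙yz≈y∙xz)
open import Data.Nat.Coprimality as Coprime
  using (Coprime; coprime-divisor; coprime⇒gcd≡1; gcd≡1⇒coprime)
open import Data.Nat.DivMod using (%-remove-+ʳ; m≡m%n+[m/n]*n; m%n<n; /-monoˡ-≤; m/n*n≤m)
open import Data.Nat.Divisibility
  using (_∣_; _∣?_; divides; ∣-trans; ∣1⇒≡1; ∣⇒≤; m∣m*n; n∣m*n; *-monoˡ-∣; *-monoʳ-∣; m≤n⇒m!∣n!)
open import Data.Nat.GCD
  using (gcd; gcd-greatest; gcd-zeroˡ; gcd[m,n]≢0; gcd[m,n]∣m; gcd[m,n]∣n; gcd[m,n]≤n)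
open import Data.Nat.ListAction using (sum; product)
open import Data.Nat.Primality
  using (Prime; prime⇒irreducible; prime⇒nonZero; ¬prime[1]; productOfPrimes≢0)
open import Data.Nat.Primality.Factorisation using (PrimeFactorisation; factorise)
open import Data.Nat.Tactic.RingSolver using (solve-∀)
open import Data.Product using (_×_; _,_; proj₁; proj₂; ∃-syntax)
open import Data.Sum using (inj₁; inj₂)
open import Data.Vec using ([]; _∷_; here; there) renaming (tabulate to tabulateⱽ)
open import Data.Vec.Properties using (lookup∘tabulate; []=⇒lookup; lookup⇒[]=)
open import Function using (_∘_; id)
open import Function.Bundles using (_⇔_; mk⇔; Equivalence)
open import Function.Properties.Equivalence using () renaming (trans to ⇔-trans)
open import Relation.Nullary using (¬_; Dec; yes; no; does; contradiction)
open import Relation.Nullary.Decidable using (_×-dec_; _→-dec_; ¬?; dec-true; dec-false)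
open import Relation.Unary using (Decidable)
open import Relation.Unary.Properties using (_∩?_; ∁?)
open import Relation.Binary.PropositionalEquality

open Equivalence using (to; from)

sum-map-mono : ∀ {B : Set} {f g : B → ℕ} (T : List B) →
               (∀ b → f b ≤ g b) → sum (map f T) ≤ sum (map g T)
sum-map-mono []      f≤g = z≤n
sum-map-mono (t ∷ T) f≤g = +-mono-≤ (f≤g t) (sum-map-mono T f≤g)

sum-map-strict : ∀ {B : Set} {f g : B → ℕ} {T : List B} →
                 (∀ b → f b ≤ g b) → Any (λ b → f b < g b) T → sum (map f T) < sum (map g T)
sum-map-strict {T = _ ∷ T} f≤g (here f<g)  = +-mono-<-≤ f<g (sum-map-mono T f≤g)
sum-map-strict {T = t ∷ _} f≤g (there any) = +-mono-≤-< (f≤g t) (sum-map-strict f≤g any)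

sum-map-bound : ∀ {B : Set} {f : B → ℕ} {K C : ℕ} (T : List B) →
                (∀ b → f b * K ≤ C) → sum (map f T) * K ≤ length T * C
sum-map-bound []                     _     = z≤n
sum-map-bound {f = f} {K} {C} (t ∷ T) fK≤C = begin
  (f t + sum (map f T)) * K    ≡⟨ *-distribʳ-+ K (f t) _ ⟩
  f t * K + sum (map f T) * K  ≤⟨ +-mono-≤ (fK≤C t) (sum-map-bound T fK≤C) ⟩
  C + length T * C             ∎
  where open ≤-Reasoning

module _ {A : Set} {P : A → Set} (P? : Decidable P) where

  length-filter-∷ : ∀ x xs → length (filter P? xs) ≤ length (filter P? (x ∷ xs))
  length-filter-∷ x xs with P? x
  ... | yes _ = n≤1+n _
  ... | no  _ = ≤-refl

  length-filter-∷-accept : ∀ {x} xs → P x → length (filter P? xs) < length (filter P? (x ∷ xs))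
  length-filter-∷-accept xs px rewrite filter-accept P? {xs = xs} px = ≤-refl

  length-filter-split : ∀ {Q : A → Set} (Q? : Decidable Q) xs →
    length (filter P? xs) ≡ length (filter (P? ∩? Q?) xs) + length (filter (P? ∩? ∁? Q?) xs)
  length-filter-split Q? [] = refl
  length-filter-split Q? (x ∷ xs) with P? x | Q? x
  ... | yes _ | yes _ = cong suc (length-filter-split Q? xs)
  ... | yes _ | no  _ = trans (cong suc (length-filter-split Q? xs)) (sym (+-suc _ _))
  ... | no  _ | _     = length-filter-split Q? xs

module _ {A B : Set} {P : B → A → Set} (P? : ∀ b → Decidable (P b)) where

  covered-length : (T : List B) (xs : List A) → All (λ x → Any (λ b → P b x) T) xs →
                   length xs ≤ sum (map (λ b → length (filter (P? b) xs)) T)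
  covered-length T []       []         = z≤n
  covered-length T (x ∷ xs) (px ∷ pxs) = ≤-trans (s≤s (covered-length T xs pxs))
    (sum-map-strict (λ b → length-filter-∷ (P? b) x xs)
                    (Any.map (λ {b} pbx → length-filter-∷-accept (P? b) xs pbx) px))

  pigeonhole : ∀ {K C} (T : List B) (xs : List A) → All (λ x → Any (λ b → P b x) T) xs →
               (∀ b → length (filter (P? b) xs) * K ≤ C) → length xs * K ≤ length T * C
  pigeonhole {K} T xs covered bound =
    ≤-trans (*-monoˡ-≤ K (covered-length T xs covered)) (sum-map-bound T bound)

-- A subset has as many elements as there are indices i satisfying its
-- characteristic predicate; stated for an arbitrary indexing f so that the induction on
-- the vector goes through (we use f = id, i.e. the list allFin n).
size-by-filter : ∀ {n} {A : Set} {P : A → Set} (P? : Decidable P) (S : Subset n) (f : Fin n → A) →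
                 (∀ i → i ∈ S ⇔ P (f i)) → ∣ S ∣ ≡ length (filter P? (tabulateᴸ f))
size-by-filter P? []      f S≐P = refl
size-by-filter P? (s ∷ S) f S≐P with size-by-filter P? S (f ∘ fsuc) tail-≐
  where
  tail-≐ : ∀ i → i ∈ S ⇔ _
  tail-≐ i = mk⇔ (to (S≐P (fsuc i)) ∘ there) (drop-there ∘ from (S≐P (fsuc i)))
size-by-filter P? (inside ∷ S)  f S≐P | ∣S∣≡ =
  trans (cong suc ∣S∣≡) (sym (cong length (filter-accept P? (to (S≐P fzero) here))))
size-by-filter P? (outside ∷ S) f S≐P | ∣S∣≡ =
  trans ∣S∣≡ (sym (cong length (filter-reject P? (λ p → zero∉ (from (S≐P fzero) p)))))
  where
  zero∉ : ∀ {n} {S : Subset n} → fzero ∈ outside ∷ S → _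
  zero∉ ()

subsetOf : ∀ {n} {P : Fin n → Set} → Decidable P → Subset n
subsetOf P? = tabulateⱽ (does ∘ P?)

∈-subsetOf : ∀ {n} {P : Fin n → Set} (P? : Decidable P) i → i ∈ subsetOf P? ⇔ P i
∈-subsetOf P? i = mk⇔ member⇒P P⇒member
  where
  member⇒P : i ∈ subsetOf P? → _
  member⇒P i∈ with P? i | trans (sym (lookup∘tabulate (does ∘ P?) i)) ([]=⇒lookup i∈)
  ... | yes p | _  = p
  ... | no  _ | ()
  P⇒member : _ → i ∈ subsetOf P?
  P⇒member p = lookup⇒[]= i _ (trans (lookup∘tabulate (does ∘ P?) i) (dec-true (P? i) p))

coprime-∣ : ∀ {a m d} → Coprime a m → d ∣ m → Coprime a d
coprime-∣ a⊥m d∣m (e∣a , e∣d) = a⊥m (e∣a , ∣-trans e∣d d∣m)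

prime-coprime : ∀ {q a} → Prime q → ¬ q ∣ a → Coprime a q
prime-coprime q-prime q∤a (d∣a , d∣q) with prime⇒irreducible q-prime d∣q
... | inj₁ d≡1  = d≡1
... | inj₂ refl = contradiction d∣a q∤a

coprime-* : ∀ {a q m} → Coprime a q → Coprime a m → Coprime a (q * m)
coprime-* {a} {q} a⊥q a⊥m {d} (d∣a , d∣qm) = a⊥m (d∣a , coprime-divisor d⊥q d∣qm)
  where
  d⊥q : Coprime d q
  d⊥q (e∣d , e∣q) = a⊥q (∣-trans e∣d d∣a , e∣q)

coprime-descend : ∀ {q M′ y} → Prime q → ¬ q ∣ y → ¬ Coprime y (q * M′) → ¬ Coprime y M′
coprime-descend q-prime q∤y ¬coprime coprime = ¬coprime (coprime-* (prime-coprime q-prime q∤y) coprime)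

coprime-*-∣ : ∀ {a b n} → Coprime a b → a ∣ n → b ∣ n → a * b ∣ n
coprime-*-∣ {a} {b} a⊥b a∣n (divides t refl) =
  *-monoˡ-∣ b (coprime-divisor a⊥b (subst (a ∣_) (*-comm t b) a∣n))

module _ {q : ℕ} .{{_ : NonZero q}} where

  ∸-divisible⇔%≡ : ∀ {a b} → a ≤ b → q ∣ b ∸ a ⇔ a % q ≡ b % q
  ∸-divisible⇔%≡ {a} {b} a≤b = mk⇔ divisible⇒%≡ %≡⇒divisible
    where
    open ≡-Reasoning
    divisible⇒%≡ : q ∣ b ∸ a → a % q ≡ b % q
    divisible⇒%≡ q∣b∸a = begin
      a % q             ≡⟨ %-remove-+ʳ a q∣b∸a ⟨
      (a + (b ∸ a)) % q ≡⟨ cong (_% q) (m+[n∸m]≡n a≤b) ⟩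
      b % q             ∎
    %≡⇒divisible : a % q ≡ b % q → q ∣ b ∸ a
    %≡⇒divisible a%q≡b%q = divides (b / q ∸ a / q) (begin
      b ∸ a
        ≡⟨ cong₂ _∸_ (m≡m%n+[m/n]*n b q) (m≡m%n+[m/n]*n a q) ⟩
      (b % q + b / q * q) ∸ (a % q + a / q * q)
        ≡⟨ cong (λ r → (b % q + b / q * q) ∸ (r + a / q * q)) a%q≡b%q ⟩
      (b % q + b / q * q) ∸ (b % q + a / q * q)
        ≡⟨ [m+n]∸[m+o]≡n∸o (b % q) _ _ ⟩
      b / q * q ∸ a / q * q
        ≡⟨ *-distribʳ-∸ q (b / q) (a / q) ⟨
      (b / q ∸ a / q) * q ∎)

  difference-divisible⇔%≡ : ∀ a b → q ∣ ∣ a - b ∣ ⇔ a % q ≡ b % q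
  difference-divisible⇔%≡ a b with ≤-total a b
  ... | inj₁ a≤b = subst (λ d → q ∣ d ⇔ a % q ≡ b % q) (sym (m≤n⇒∣m-n∣≡n∸m a≤b))
                         (∸-divisible⇔%≡ a≤b)
  ... | inj₂ b≤a = subst (λ d → q ∣ d ⇔ a % q ≡ b % q) (trans (sym (m≤n⇒∣m-n∣≡n∸m b≤a)) (∣-∣-comm b a))
                         (⇔-trans (∸-divisible⇔%≡ b≤a) (mk⇔ sym sym))

-- A pair (v , u) stands for a vertex v of X_M with a chosen neighbour u.

Pair : Set
Pair = ℕ × ℕ

Good : ℕ → Pair → Set
Good M (v , u) = Coprime ∣ v - u ∣ M

Crossing : ℕ → Pair → Pair → Set
Crossing M (v , u) (v′ , u′) = ¬ Coprime ∣ v′ - u ∣ M × ¬ Coprime ∣ v - u′ ∣ M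

CrossFamily : ℕ → List Pair → Set
CrossFamily M ps = All (Good M) ps × AllPairs (Crossing M) ps

allPairs-filter : ∀ {A : Set} {P : A → Set} {R R′ : A → A → Set} (P? : Decidable P) →
                  (∀ {x y} → P x → P y → R x y → R′ x y) →
                  ∀ {xs} → AllPairs R xs → AllPairs R′ (filter P? xs)
allPairs-filter P? weaken []                  = []
allPairs-filter P? weaken {x ∷ xs} (rx ∷ rxs) with P? x
... | yes px = All.zipWith (λ (r , py) → weaken px py r)
                           (Allₚ.filter⁺ P? rx , Allₚ.all-filter P? xs)
               ∷ allPairs-filter P? weaken rxs
... | no  _  = allPairs-filter P? weaken rxs

cross-filter : ∀ {M M′} {Sel : Pair → Set} (Sel? : Decidable Sel) →
               (∀ p → Good M p → Good M′ p) →
               (∀ p p′ → Sel p → Sel p′ → Crossing M p p′ → Crossing M′ p p′) →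
               ∀ {ps} → CrossFamily M ps → CrossFamily M′ (filter Sel? ps)
cross-filter Sel? good↓ crossing↓ (goods , crossings) =
  All.map (λ {p} → good↓ p) (Allₚ.filter⁺ Sel? goods) ,
  allPairs-filter Sel? (crossing↓ _ _) crossings

-- Modulo 1 nothing is non-coprime, so no two pairs can cross.
cross-family-1 : ∀ {ps} → CrossFamily 1 ps → length ps ≤ 1
cross-family-1 {[]}        _ = z≤n
cross-family-1 {_ ∷ []}    _ = ≤-refl
cross-family-1 {_ ∷ _ ∷ _} (_ , ((¬coprime , _) ∷ _) ∷ _) =
  ⊥-elim (¬coprime (λ (_ , d∣1) → ∣1⇒≡1 d∣1))

Test : Set
Test = ℕ → Bool

Separates : Test → ℕ → ℕ → Set
Separates τ a b = τ a ≡ false × τ b ≡ true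

separates? : ∀ τ a b → Dec (Separates τ a b)
separates? τ a b = (τ a Bool.≟ false) ×-dec (τ b Bool.≟ true)

SeparatingFamily : ℕ → List Test → Set
SeparatingFamily q T = ∀ a b → b < q → a ≢ b → Any (λ τ → Separates τ a b) T

separated⇒∤ : ∀ {q} .{{_ : NonZero q}} τ a b → Separates τ (a % q) (b % q) → ¬ q ∣ ∣ a - b ∣
separated⇒∤ τ a b (τa≡false , τb≡true) q∣a-b
  with () ← trans (sym τa≡false) (trans (cong τ (to (difference-divisible⇔%≡ a b) q∣a-b)) τb≡true)

-- For a test τ,
-- select the pairs (v , u) where τ rejects v mod q and accepts u mod q.  Every good pair
-- modulo q·M′ has v ≢ u mod q, so it is selected by some test; and among selected pairs
-- every crossing difference v′ − u has v′ ≢ u mod q, so its common factor with q·M′ lies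
-- in M′.  Thus each selection is a cross family modulo M′, and pigeonhole applies.
split-bound : ∀ {q M′ K C} {T : List Test} → Prime q → ¬ q ∣ M′ → SeparatingFamily q T →
              (∀ ps → CrossFamily M′ ps → length ps * K ≤ C) →
              ∀ ps → CrossFamily (q * M′) ps → length ps * K ≤ length T * C
split-bound {q} {M′} {T = T} q-prime q∤M′ separating bound ps cf =
  pigeonhole selects? T ps covered (λ τ → bound _ (cross-filter (selects? τ) good↓ (crossing↓ τ) cf))
  where
  instance
    _ : NonZero q
    _ = prime⇒nonZero q-prime
  Selects : Test → Pair → Set
  Selects τ (v , u) = Separates τ (v % q) (u % q)
  selects? : ∀ τ → Decidable (Selects τ)
  selects? τ (v , u) = separates? τ (v % q) (u % q)
  covered : All (λ p → Any (λ τ → Selects τ p) T) ps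
  covered = All.map (λ {(v , u)} v⊥u → separating (v % q) (u % q) (m%n<n u q)
                       (λ v≡u → ¬coprime (from (difference-divisible⇔%≡ v u) v≡u) v⊥u))
                    (proj₁ cf)
    where
    ¬coprime : ∀ {y} → q ∣ y → ¬ Coprime y (q * M′)
    ¬coprime q∣y y⊥qM′ = ¬prime[1] (subst Prime (y⊥qM′ (q∣y , m∣m*n M′)) q-prime)
  good↓ : ∀ p → Good (q * M′) p → Good M′ p
  good↓ _ v⊥u = coprime-∣ v⊥u (n∣m*n q)
  crossing↓ : ∀ τ p p′ → Selects τ p → Selects τ p′ →
              Crossing (q * M′) p p′ → Crossing M′ p p′
  crossing↓ τ (v , u) (v′ , u′) (τv≡false , τu≡true) (τv′≡false , τu′≡true) (¬c₁ , ¬c₂) =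
    coprime-descend q-prime (separated⇒∤ τ v′ u (τv′≡false , τu≡true)) ¬c₁ ,
    coprime-descend q-prime (separated⇒∤ τ v u′ (τv≡false , τu′≡true)) ¬c₂

point-tests : ℕ → List Test
point-tests q = map (λ β a → does (a ≟ β)) (upTo q)

point-tests-separating : ∀ q → SeparatingFamily q (point-tests q)
point-tests-separating q a b b<q a≢b =
  Anyₚ.map⁺ (lose (∈-upTo⁺ b<q) (dec-false (a ≟ b) a≢b , dec-true (b ≟ b) refl))

length-point-tests : ∀ q → length (point-tests q) ≡ q
length-point-tests q = trans (length-map _ (upTo q)) (length-upTo q)

module _ (B : ℕ) .{{_ : NonZero B}} where

  digit-tests : ℕ → List Test
  digit-tests q = map (λ β a → does (a % B ≟ β)) (upTo B)
               ++ map (λ β a → does (a / B ≟ β)) (upTo (suc (q / B)))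

  digit-tests-separating : ∀ q → SeparatingFamily q (digit-tests q)
  digit-tests-separating q a b b<q a≢b with a % B ≟ b % B
  ... | no  a%≢b% = Anyₚ.++⁺ˡ (Anyₚ.map⁺ (lose (∈-upTo⁺ (m%n<n b B))
                      (dec-false (a % B ≟ b % B) a%≢b% , dec-true (b % B ≟ b % B) refl)))
  ... | yes a%≡b% = Anyₚ.++⁺ʳ _ (Anyₚ.map⁺ (lose (∈-upTo⁺ (s≤s (/-monoˡ-≤ B (<⇒≤ b<q))))
                      (dec-false (a / B ≟ b / B) a/≢b/ , dec-true (b / B ≟ b / B) refl)))
    where
    a/≢b/ : a / B ≢ b / B
    a/≢b/ a/≡b/ = a≢b (begin
      a                 ≡⟨ m≡m%n+[m/n]*n a B ⟩
      a % B + a / B * B ≡⟨ cong₂ (λ r s → r + s * B) a%≡b% a/≡b/ ⟩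
      b % B + b / B * B ≡⟨ m≡m%n+[m/n]*n b B ⟨
      b                 ∎)
      where open ≡-Reasoning

  length-digit-tests : ∀ q → length (digit-tests q) ≡ B + suc (q / B)
  length-digit-tests q = begin
    length (digit-tests q)
      ≡⟨ length-++ (map _ (upTo B)) ⟩
    length (map _ (upTo B)) + length (map _ (upTo (suc (q / B))))
      ≡⟨ cong₂ _+_ (length-map _ (upTo B)) (length-map _ (upTo (suc (q / B)))) ⟩
    length (upTo B) + length (upTo (suc (q / B)))
      ≡⟨ cong₂ _+_ (length-upTo B) (length-upTo (suc (q / B))) ⟩
    B + suc (q / B) ∎
    where open ≡-Reasoning

-- For a scale K ≥ 1, primes below Q = (2K+1)·2K are "small" and
-- are handled with point tests; larger ones with base-2K digit tests, of which there are at
-- most q/K.  The invariant, proved along the prime factorisation of M, is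
--   length ps · K ≤ M ⊔ K · gcd(M, Q!)
-- for every cross family ps modulo M.
module CrossBound (K : ℕ) .{{_ : NonZero K}} where

  B : ℕ
  B = K + K

  Q : ℕ
  Q = (B + 1) * B

  G : ℕ
  G = Q !

  instance
    B-nonZero : NonZero B
    B-nonZero = >-nonZero (≤-trans (>-nonZero⁻¹ K) (m≤m+n K K))

    G-nonZero : NonZero G
    G-nonZero = Q !≢0

  gcd-G-nonZero : ∀ M → NonZero (gcd M G)
  gcd-G-nonZero M = ≢-nonZero (gcd[m,n]≢0 M G (inj₂ (≢-nonZero⁻¹ G)))

  digit-tests-few : ∀ q → Q ≤ q → length (digit-tests B q) * K ≤ q
  digit-tests-few q Q≤q rewrite length-digit-tests B q = *-cancelˡ-≤ 2 (begin
    2 * ((B + suc (q / B)) * K) ≡⟨ count-identity K (q / B) ⟩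
    Q + q / B * B               ≤⟨ +-mono-≤ Q≤q (m/n*n≤m q B) ⟩
    q + q                       ≡⟨ cong (q +_) (+-identityʳ q) ⟨
    2 * q                       ∎)
    where
    open ≤-Reasoning
    count-identity : ∀ k t → 2 * ((k + k + suc t) * k) ≡ (k + k + 1) * (k + k) + t * (k + k)
    count-identity = solve-∀

  small-∣G : ∀ q → 1 ≤ q → q ≤ Q → q ∣ G
  small-∣G (suc q₀) _ q≤Q = ∣-trans (m∣m*n (q₀ !)) (m≤n⇒m!∣n! q≤Q)

  Bound : ℕ → ℕ
  Bound M = M ⊔ K * gcd M G

  BoundedAt : ℕ → Set
  BoundedAt M = ∀ ps → CrossFamily M ps → length ps * K ≤ Bound M

  bound-1 : BoundedAt 1
  bound-1 ps cf = begin
    length ps * K ≤⟨ *-monoˡ-≤ K (cross-family-1 cf) ⟩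
    1 * K         ≡⟨ *-identityˡ K ⟩
    K             ≡⟨ *-identityʳ K ⟨
    K * 1         ≡⟨ cong (K *_) (gcd-zeroˡ G) ⟨
    K * gcd 1 G   ≤⟨ m≤n⊔m 1 _ ⟩
    Bound 1       ∎
    where open ≤-Reasoning

  -- A repeated prime factor q ∣ M′ changes nothing: coprimality to q·M′ and to M′ agree.
  divisible-step : ∀ {q M′} .{{_ : NonZero q}} → q ∣ M′ → BoundedAt M′ → BoundedAt (q * M′)
  divisible-step {q} {M′} q∣M′ bounded ps (goods , crossings) = begin
    length ps * K     ≤⟨ bounded ps (All.map (λ {p} → good↓ p) goods ,
                                     AllPairs.map (λ {p p′} → crossing↓ p p′) crossings) ⟩
    M′ ⊔ K * gcd M′ G ≤⟨ ⊔-mono-≤ (m≤n*m M′ q) (*-monoʳ-≤ K (∣⇒≤ g′∣g)) ⟩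
    Bound (q * M′)    ∎
    where
    open ≤-Reasoning
    instance _ = gcd-G-nonZero (q * M′)
    good↓ : ∀ p → Good (q * M′) p → Good M′ p
    good↓ _ v⊥u = coprime-∣ v⊥u (n∣m*n q)
    descend : ∀ {y} → ¬ Coprime y (q * M′) → ¬ Coprime y M′
    descend ¬coprime coprime = ¬coprime (coprime-* (coprime-∣ coprime q∣M′) coprime)
    crossing↓ : ∀ p p′ → Crossing (q * M′) p p′ → Crossing M′ p p′
    crossing↓ _ _ (¬c₁ , ¬c₂) = descend ¬c₁ , descend ¬c₂
    g′∣g : gcd M′ G ∣ gcd (q * M′) G
    g′∣g = gcd-greatest (∣-trans (gcd[m,n]∣m M′ G) (n∣m*n q)) (gcd[m,n]∣n M′ G)

  -- A new small prime multiplies the bound by q; the factor q is absorbed by gcd(q·M′, G),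
  -- since q ∣ G and q is coprime to gcd(M′, G).
  small-prime-step : ∀ {q M′} → Prime q → ¬ q ∣ M′ → q < Q → BoundedAt M′ → BoundedAt (q * M′)
  small-prime-step {q} {M′} q-prime q∤M′ q<Q bounded ps cf = begin
    length ps * K
      ≤⟨ split-bound q-prime q∤M′ (point-tests-separating q) bounded ps cf ⟩
    length (point-tests q) * Bound M′  ≡⟨ cong (_* Bound M′) (length-point-tests q) ⟩
    q * (M′ ⊔ K * g′)                  ≡⟨ *-distribˡ-⊔ q M′ (K * g′) ⟩
    q * M′ ⊔ q * (K * g′)              ≡⟨ cong (q * M′ ⊔_) (x∙yz≈y∙xz q K g′) ⟩
    q * M′ ⊔ K * (q * g′)              ≤⟨ ⊔-monoʳ-≤ (q * M′) (*-monoʳ-≤ K (∣⇒≤ qg′∣g)) ⟩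
    Bound (q * M′)                     ∎
    where
    open ≤-Reasoning
    instance
      _ = gcd-G-nonZero (q * M′)
      _ = prime⇒nonZero q-prime
    g′ : ℕ
    g′ = gcd M′ G
    q⊥g′ : Coprime q g′
    q⊥g′ = Coprime.sym (prime-coprime q-prime
             (λ q∣g′ → q∤M′ (∣-trans q∣g′ (gcd[m,n]∣m M′ G))))
    qg′∣g : q * g′ ∣ gcd (q * M′) G
    qg′∣g = gcd-greatest (*-monoʳ-∣ q (gcd[m,n]∣m M′ G))
              (coprime-*-∣ q⊥g′ (small-∣G q (>-nonZero⁻¹ q) (<⇒≤ q<Q)) (gcd[m,n]∣n M′ G))

  -- A new large prime: the digit tests split the family into at most q/K cross families
  -- modulo M′, each of length at most M′.
  large-prime-step : ∀ {q M′} .{{_ : NonZero M′}} → Prime q → ¬ q ∣ M′ → Q ≤ q →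
                     BoundedAt M′ → BoundedAt (q * M′)
  large-prime-step {q} {M′} q-prime q∤M′ Q≤q bounded ps cf = begin
    length ps * K
      ≤⟨ split-bound q-prime q∤M′ (digit-tests-separating B q) bounded′ ps cf ⟩
    length (digit-tests B q) * (K * M′) ≡⟨ *-assoc (length (digit-tests B q)) K M′ ⟨
    length (digit-tests B q) * K * M′   ≤⟨ *-monoˡ-≤ M′ (digit-tests-few q Q≤q) ⟩
    q * M′                              ≤⟨ m≤m⊔n (q * M′) _ ⟩
    Bound (q * M′)                      ∎
    where
    open ≤-Reasoning
    -- as gcd(M′, G) ≤ M′, the invariant at M′ gives the plain bound K·M′
    bounded′ : ∀ ps → CrossFamily M′ ps → length ps * K ≤ K * M′
    bounded′ ps cf = ≤-trans (bounded ps cf)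
      (⊔-lub (m≤n*m M′ K) (*-monoʳ-≤ K (∣⇒≤ (gcd[m,n]∣m M′ G))))

  product-bound : ∀ fs → All Prime fs → BoundedAt (product fs)
  product-bound []       []                 = bound-1
  product-bound (q ∷ fs) (q-prime ∷ primes) with q ∣? product fs | q <? Q
  ... | yes q∣M′ | _       = divisible-step {{prime⇒nonZero q-prime}} q∣M′ (product-bound fs primes)
  ... | no  q∤M′ | yes q<Q = small-prime-step q-prime q∤M′ q<Q (product-bound fs primes)
  ... | no  q∤M′ | no  q≮Q = large-prime-step {{productOfPrimes≢0 primes}} q-prime q∤M′
                                (≮⇒≥ q≮Q) (product-bound fs primes)

  cross-family-bound : ∀ n .{{_ : NonZero n}} → K * G ≤ n →
                       ∀ ps → CrossFamily n ps → length ps * K ≤ n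
  cross-family-bound n KG≤n ps cf =
    ≤-trans (subst BoundedAt (sym isFactorisation) (product-bound factors factorsPrime) ps cf)
            (⊔-lub ≤-refl (≤-trans (*-monoʳ-≤ K (gcd[m,n]≤n n G)) KG≤n))
    where open PrimeFactorisation (factorise n)

adj? : ∀ n a b → Dec (Adj n a b)
adj? n a b = ¬? (toℕ a ≟ toℕ b) ×-dec (gcd ∣ toℕ a - toℕ b ∣ n ≟ 1)

-- Independent sets are irredundant: every vertex is its own private neighbour.
independent⇒irredundant : ∀ n S → Independent n S → Irredundant n S
independent⇒irredundant n S independent v v∈S = v , inj₁ refl , not-dominated
  where
  not-dominated : ∀ w → w ∈ S → w ≢ v → ¬ InClosedNbhd n v w
  not-dominated w w∈S w≢v (inj₁ v≡w) = w≢v (sym v≡w)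
  not-dominated w w∈S w≢v (inj₂ w~v) = independent w v w∈S v∈S w~v

α≤IR : ∀ {n a i} → IsAlpha n a → IsIR n i → a ≤ i
α≤IR ((S , independent , ∣S∣≡a) , _) (_ , IR-max) =
  subst (_≤ _) ∣S∣≡a (IR-max S (independent⇒irredundant _ S independent))

module Irredundance {n : ℕ} (S : Subset n) where

  Isolated : Fin n → Set
  Isolated v = ∀ w → w ∈ S → ¬ Adj n w v

  isolated? : Decidable Isolated
  isolated? v = all? (λ w → (w ∈? S) →-dec ¬? (adj? n w v))

  IsolatedMember NonIsolatedMember : Fin n → Set
  IsolatedMember    v = v ∈ S × Isolated v
  NonIsolatedMember v = v ∈ S × ¬ Isolated v

  member? : Decidable (_∈ S)
  member? v = v ∈? S

  isolated-member? : Decidable IsolatedMember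
  isolated-member? = member? ∩? isolated?

  non-isolated-member? : Decidable NonIsolatedMember
  non-isolated-member? = member? ∩? ∁? isolated?

  isolated-members : Subset n
  isolated-members = subsetOf isolated-member?

  isolated-members-independent : Independent n isolated-members
  isolated-members-independent a b a∈ b∈ = b-isolated a a∈S
    where
    a∈S = proj₁ (to (∈-subsetOf isolated-member? a) a∈)
    b-isolated = proj₂ (to (∈-subsetOf isolated-member? b) b∈)

  non-isolated : List (Fin n)
  non-isolated = filter non-isolated-member? (allFin n)

  non-isolated-unique : Unique non-isolated
  non-isolated-unique = AllPairsₚ.filter⁺ non-isolated-member? (allFin⁺ n)

  non-isolated-members : All NonIsolatedMember non-isolated
  non-isolated-members = Allₚ.all-filter non-isolated-member? (allFin n)

  size-split : ∣ S ∣ ≡ ∣ isolated-members ∣ + length non-isolated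
  size-split = begin
    ∣ S ∣
      ≡⟨ size-by-filter member? S id (λ _ → mk⇔ id id) ⟩
    length (filter member? (allFin n))
      ≡⟨ length-filter-split member? isolated? (allFin n) ⟩
    length (filter isolated-member? (allFin n)) + length non-isolated
      ≡⟨ cong (_+ length non-isolated) (size-by-filter _ isolated-members id (∈-subsetOf isolated-member?)) ⟨
    ∣ isolated-members ∣ + length non-isolated
      ∎
    where open ≡-Reasoning

  PrivatePartner : Fin n → Fin n → Set
  PrivatePartner v u = Adj n v u × (∀ w → w ∈ S → w ≢ v → ¬ InClosedNbhd n u w)

  module _ (irredundant : Irredundant n S) where

    -- A member with a neighbour in S cannot be its own private neighbour, so its private
    -- neighbour is adjacent to it.
    private-partner : ∀ {v} → NonIsolatedMember v → ∃[ u ] PrivatePartner v u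
    private-partner {v} (v∈S , ¬isolated) with irredundant v v∈S
    ... | u , inj₂ v~u , priv = u , v~u , priv
    ... | _ , inj₁ refl , priv =
      ⊥-elim (¬isolated (λ w w∈S w~v → priv w w∈S (λ { refl → proj₁ w~v refl }) (inj₂ w~v)))

    partner : ∀ {v} → NonIsolatedMember v → Fin n
    partner m = proj₁ (private-partner m)

    partner-pair : ∀ {v} → NonIsolatedMember v → Pair
    partner-pair {v} m = toℕ v , toℕ (partner m)

    partner-pairs : (vs : List (Fin n)) → All NonIsolatedMember vs → List Pair
    partner-pairs []       []       = []
    partner-pairs (v ∷ vs) (m ∷ ms) = partner-pair m ∷ partner-pairs vs ms

    length-partner-pairs : ∀ vs ms → length (partner-pairs vs ms) ≡ length vs
    length-partner-pairs []       []       = refl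
    length-partner-pairs (v ∷ vs) (m ∷ ms) = cong suc (length-partner-pairs vs ms)

    partner-good : ∀ {v} (m : NonIsolatedMember v) → Good n (partner-pair m)
    partner-good m = gcd≡1⇒coprime (proj₂ (proj₁ (proj₂ (private-partner m))))

    partner-unreachable : ∀ {v w} (m : NonIsolatedMember v) → w ∈ S → w ≢ v →
                          ¬ Coprime ∣ toℕ w - toℕ (partner m) ∣ n
    partner-unreachable {w = w} m w∈S w≢v coprime with private-partner m
    ... | u , _ , priv = priv w w∈S w≢v (inj₂ (w≢u , coprime⇒gcd≡1 coprime))
      where
      w≢u : toℕ w ≢ toℕ u
      w≢u w≡u = priv w w∈S w≢v (inj₁ (sym (toℕ-injective w≡u)))

    partner-crossing : ∀ {v} (m : NonIsolatedMember v) {vs} → All (v ≢_) vs →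
                       (ms : All NonIsolatedMember vs) → All (Crossing n (partner-pair m)) (partner-pairs vs ms)
    partner-crossing m []            []         = []
    partner-crossing m (v≢v′ ∷ v≢vs) (m′ ∷ ms′) =
      (partner-unreachable m (proj₁ m′) (v≢v′ ∘ sym) , partner-unreachable m′ (proj₁ m) v≢v′)
      ∷ partner-crossing m v≢vs ms′

    partner-pairs-cross : ∀ {vs} → Unique vs → (ms : All NonIsolatedMember vs) →
                          CrossFamily n (partner-pairs vs ms)
    partner-pairs-cross []              []       = [] , []
    partner-pairs-cross (v∉vs ∷ unique) (m ∷ ms) =
      partner-good m ∷ proj₁ (partner-pairs-cross unique ms) ,
      partner-crossing m v∉vs ms ∷ proj₂ (partner-pairs-cross unique ms)

    partner-family : List Pair
    partner-family = partner-pairs non-isolated non-isolated-members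

    partner-family-cross : CrossFamily n partner-family
    partner-family-cross = partner-pairs-cross non-isolated-unique non-isolated-members

    irredundant-bound : ∀ {a} → IsAlpha n a → ∣ S ∣ ≤ a + length partner-family
    irredundant-bound {a} (_ , α-max) = begin
      ∣ S ∣                                        ≡⟨ size-split ⟩
      ∣ isolated-members ∣ + length non-isolated   ≡⟨ cong (_ +_) (length-partner-pairs _ non-isolated-members) ⟨
      ∣ isolated-members ∣ + length partner-family ≤⟨ +-monoˡ-≤ _ (α-max _ isolated-members-independent) ⟩
      a + length partner-family                    ∎
      where open ≤-Reasoning

-- If d ∣ n with d ≥ 2, the d residue classes mod d are independent and cover all n
-- vertices, so n ≤ d·α.
α-lower-bound : ∀ {n d a} → 2 ≤ d → d ∣ n → IsAlpha n a → n ≤ d * a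
α-lower-bound {n} {d} {a} 2≤d d∣n (_ , α-max) = begin
  n                        ≡⟨ *-identityʳ n ⟨
  n * 1                    ≡⟨ cong (_* 1) (length-tabulate {n = n} id) ⟨
  length (allFin n) * 1    ≤⟨ pigeonhole class? (allFin d) (allFin n) covered class-bound ⟩
  length (allFin d) * a    ≡⟨ cong (_* a) (length-tabulate {n = d} id) ⟩
  d * a                    ∎
  where
  open ≤-Reasoning
  instance
    _ : NonZero d
    _ = >-nonZero (≤-trans (s≤s z≤n) 2≤d)
  Class : Fin d → Fin n → Set
  Class c v = toℕ v % d ≡ toℕ c
  class? : ∀ c → Decidable (Class c)
  class? c v = toℕ v % d ≟ toℕ c
  covered : All (λ v → Any (λ c → Class c v) (allFin d)) (allFin n)
  covered = Allₚ.tabulate⁺ (λ v → lose (∈-allFin (fromℕ< (m%n<n (toℕ v) d))) (sym (toℕ-fromℕ< _)))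
  -- two vertices of a class differ by a multiple of d, a common factor with n
  class-independent : ∀ c → Independent n (subsetOf (class? c))
  class-independent c v w v∈ w∈ (_ , gcd≡1) = <⇒≢ 2≤d (sym (∣1⇒≡1 (subst (d ∣_) gcd≡1 d∣gcd)))
    where
    same-residue : toℕ v % d ≡ toℕ w % d
    same-residue = trans (to (∈-subsetOf (class? c) v) v∈) (sym (to (∈-subsetOf (class? c) w) w∈))
    d∣gcd : d ∣ gcd (∣ toℕ v - toℕ w ∣) n
    d∣gcd = gcd-greatest (from (difference-divisible⇔%≡ (toℕ v) (toℕ w)) same-residue) d∣n
  class-bound : ∀ c → length (filter (class? c) (allFin n)) * 1 ≤ a
  class-bound c = begin
    length (filter (class? c) (allFin n)) * 1 ≡⟨ *-identityʳ _ ⟩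
    length (filter (class? c) (allFin n))     ≡⟨ size-by-filter _ _ id (∈-subsetOf (class? c)) ⟨
    ∣ subsetOf (class? c) ∣                   ≤⟨ α-max _ (class-independent c) ⟩
    a                                         ∎

∣-∣-bound : ∀ {a i L} → a ≤ i → i ≤ a + L → ∣ i - a ∣ ≤ L
∣-∣-bound {a} {i} a≤i i≤a+L =
  subst (_≤ _) (trans (sym (m≤n⇒∣m-n∣≡n∸m a≤i)) (∣-∣-comm a i)) (m≤n+o⇒m∸n≤o i a i≤a+L)

half-< : ∀ {y a} → 0 < a → y + y ≤ a → y < a
half-< {zero}  0<a _    = 0<a
half-< {suc y} _   2y≤a = <-≤-trans (m<m+n (suc y) (s≤s z≤n)) 2y≤a

small-share : ∀ {r m L a} .{{_ : NonZero r}} → 0 < a → L * (r * (2 * m)) ≤ r * a → m * L < a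
small-share {r} {m} {L} {a} 0<a bound = half-< 0<a (*-cancelˡ-≤ r (subst (_≤ r * a) (rearrange r m L) bound))
  where
  rearrange : ∀ r m L → L * (r * (2 * m)) ≡ r * (m * L + m * L)
  rearrange = solve-∀

-- Corollary 5.6: with K = 2r(k+1) and N = K·Q!, for n ≥ N in D_r we have
-- α ≤ IR ≤ α + L, L·K ≤ n ≤ r·α, hence (k+1)·(IR − α) ≤ (k+1)·L < α.
corollary5p6 : ∀ (r : ℕ) → 1 ≤ r → ∀ (k : ℕ) → ∃[ N ] (∀ (n : ℕ) → N ≤ n → InD r n →
    ∀ (a i : ℕ) → IsAlpha n a → IsIR n i → suc k * ∣ i - a ∣ < a)
corollary5p6 r 1≤r k = K * G , near-equal
  where
  K : ℕ
  K = r * (2 * suc k)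
  instance
    r-nonZero : NonZero r
    r-nonZero = >-nonZero 1≤r
    K-nonZero : NonZero K
    K-nonZero = m*n≢0 r (2 * suc k)
  open CrossBound K using (G; cross-family-bound)
  near-equal : ∀ n → K * G ≤ n → InD r n → ∀ a i → IsAlpha n a → IsIR n i → suc k * ∣ i - a ∣ < a
  near-equal n KG≤n (1≤n , d , 2≤d , d≤r , d∣n) a i isα isIR@((S , irredundant , ∣S∣≡i) , _) =
    begin-strict
    suc k * ∣ i - a ∣ ≤⟨ *-monoʳ-≤ (suc k) (∣-∣-bound (α≤IR isα isIR) i≤a+L) ⟩
    suc k * L         <⟨ small-share {r} {suc k} {L} a>0 (≤-trans L·K≤n n≤r·a) ⟩
    a                 ∎
    where
    open ≤-Reasoning
    open Irredundance S using (partner-family; partner-family-cross; irredundant-bound)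
    L : ℕ
    L = length (partner-family irredundant)
    i≤a+L : i ≤ a + L
    i≤a+L = subst (_≤ a + L) ∣S∣≡i (irredundant-bound irredundant isα)
    L·K≤n : L * K ≤ n
    L·K≤n = cross-family-bound n {{>-nonZero 1≤n}} KG≤n _ (partner-family-cross irredundant)
    n≤r·a : n ≤ r * a
    n≤r·a = ≤-trans (α-lower-bound 2≤d d∣n isα) (*-monoˡ-≤ a d≤r)
    a>0 : 0 < a
    a>0 = n≢0⇒n>0 (λ a≡0 → <⇒≱ 1≤n (subst (n ≤_) (trans (cong (r *_) a≡0) (*-zeroʳ r)) n≤r·a))
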